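{- For all $n\ge1$ and $0\le k\le n$, $$M_{k,2n}=\frac{n+1}{k+1}\binom{n-1}{k}\binom{n}{k}(n!)^2=\binom{n-1}{k}\binom{n+1}{k+1}(n!)^2$$ and $$M_{k,2n+1}=\frac{1}{n-k+1}\binom{n}{k}^2((n+1)!)^2=\binom{n}{k}\binom{n+1}{k}n!(n+1)!.$$
   Context: $\mathcal{S}_m$ denotes the set of permutations $\sigma=\sigma_1\cdots\sigma_m$ of $\{1,\dots,m\}$. $\overleftarrow{des}_O(\sigma)$ is the number of indices $i\in\{1,\dots,m-1\}$ with $\sigma_i>\sigma_{i+1}$ and $\sigma_i$ odd. $M_{k,m}$ is the number of $\sigma\in\mathcal{S}_m$ with $\overleftarrow{des}_O(\sigma)=k$. Binomial coefficients $\binom{a}{b}$ are $0$ when $b<0$ or $b>a$. -}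

module Defs where

open import Data.Nat using (ℕ; zero; suc; _+_; _*_; _<ᵇ_)
open import Data.Bool using (Bool; true; false; if_then_else_; _∧_)
open import Data.List using (List; []; _∷_; concatMap; map; length; filterᵇ)
open import Data.Nat using (_≡ᵇ_)
open import Data.Nat.Base using (_%_)

insertions : ℕ → List ℕ → List (List ℕ)
insertions x [] = (x ∷ []) ∷ []
insertions x (y ∷ ys) = (x ∷ y ∷ ys) ∷ map (y ∷_) (insertions x ys)

-- S m : the list of all permutations σ₁⋯σₘ of {1,…,m} in one-line notation
-- (each exactly once), built by inserting m into every permutation of {1,…,m-1}.
S : ℕ → List (List ℕ)
S zero = [] ∷ []
S (suc m) = concatMap (insertions (suc m)) (S m)

odd : ℕ → Bool
odd n = (n % 2) ≡ᵇ 1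

desO : List ℕ → ℕ
desO [] = 0
desO (a ∷ []) = 0
desO (a ∷ b ∷ rest) = (if (b <ᵇ a) ∧ odd a then 1 else 0) + desO (b ∷ rest)

M : ℕ → ℕ → ℕ
M k m = length (filterᵇ (λ σ → desO σ ≡ᵇ k) (S m))

-- Inserting the maximum m+1 into a permutation of {1,…,m} changes desO only
-- locally.  If m+1 is even it never starts an odd descent, and it destroys the
-- odd descent of the gap it lands in; if m+1 is odd, it starts one in every gap
-- except the last, destroying at the same time the odd descent of that gap if
-- there was one.  Hence
--   M(k,m+1) = (m+1-k) M(k,m) + (k+1) M(k+1,m)      for m+1 even,
--   M(k,m+1) = (k+1) M(k,m) + (m+1-k) M(k-1,m)       for m+1 odd,
-- and the closed forms are checked to satisfy these recurrences using only
-- Pascal's rule and the absorption identities for binomial coefficients.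
module Submission where

open import Defs
open import Data.Nat using (ℕ; _+_; _*_; _≤_; suc)
open import Data.Nat.Combinatorics using (_C_)
open import Data.Nat using (_!)
open import Data.Nat using (_∸_)
open import Data.Product using (_×_)
open import Relation.Binary.PropositionalEquality using (_≡_)

open import Data.Bool using (Bool; true; false; if_then_else_; _∧_)
open import Data.Bool.Properties using (T-≡)
open import Data.List using (List; []; _∷_; _++_; map; concatMap; length; filterᵇ)
open import Data.List.Relation.Unary.All as All using (All; []; _∷_)
open import Data.List.Relation.Unary.All.Properties using (map⁺; concat⁺)
open import Data.Nat using (zero; pred; _<_; _<ᵇ_; _≡ᵇ_; _≤?_; z≤n; s≤s; z<s; s<s)
open import Data.Nat.Properties
open import Data.Nat.Combinatorics using (nC1≡n; k>n⇒nCk≡0; nCk+nC[k+1]≡[n+1]C[k+1])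
open import Data.Nat.DivMod using (m*n%n≡0; [m+kn]%n≡m%n)
open import Data.Nat.Tactic.RingSolver using (solve-∀)
open import Data.Product using (_,_)
open import Function using (_∘_; Equivalence)
open import Relation.Nullary using (yes; no)
open import Relation.Binary.PropositionalEquality using (refl; sym; trans; cong; cong₂; module ≡-Reasoning)

open ≡-Reasoning

private variable A B : Set

∑ : List A → (A → ℕ) → ℕ
∑ []       f = 0
∑ (x ∷ xs) f = f x + ∑ xs f

syntax ∑ xs (λ x → e) = ∑[ x ∈ xs ] e

∑-++ : ∀ (xs ys : List B) (f : B → ℕ) → ∑ (xs ++ ys) f ≡ ∑ xs f + ∑ ys f
∑-++ []       ys f = refl
∑-++ (x ∷ xs) ys f = trans (cong (f x +_) (∑-++ xs ys f)) (sym (+-assoc (f x) _ _))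

∑-concatMap : ∀ (h : A → List B) xs (f : B → ℕ) →
              ∑[ y ∈ concatMap h xs ] f y ≡ ∑[ x ∈ xs ] ∑[ y ∈ h x ] f y
∑-concatMap h []       f = refl
∑-concatMap h (x ∷ xs) f = trans (∑-++ (h x) _ f) (cong (∑ (h x) f +_) (∑-concatMap h xs f))

∑-map : ∀ (h : A → B) xs (f : B → ℕ) → ∑[ y ∈ map h xs ] f y ≡ ∑[ x ∈ xs ] f (h x)
∑-map h []       f = refl
∑-map h (x ∷ xs) f = cong (f (h x) +_) (∑-map h xs f)

∑-cong : ∀ {f g : A → ℕ} xs → (∀ x → f x ≡ g x) → ∑ xs f ≡ ∑ xs g
∑-cong []       f≗g = refl
∑-cong (x ∷ xs) f≗g = cong₂ _+_ (f≗g x) (∑-cong xs f≗g)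

∑-cong-All : ∀ {f g : A → ℕ} {xs} → All (λ x → f x ≡ g x) xs → ∑ xs f ≡ ∑ xs g
∑-cong-All []           = refl
∑-cong-All (fx≡gx ∷ eqs) = cong₂ _+_ fx≡gx (∑-cong-All eqs)

∑-linear : ∀ a b (f g : A → ℕ) xs →
           ∑[ x ∈ xs ] (a * f x + b * g x) ≡ a * ∑ xs f + b * ∑ xs g
∑-linear a b f g []       = sym (cong₂ _+_ (*-zeroʳ a) (*-zeroʳ b))
∑-linear a b f g (x ∷ xs) =
  trans (cong (a * f x + b * g x +_) (∑-linear a b f g xs))
        (interchange a b (f x) (g x) (∑ xs f) (∑ xs g))
  where
  interchange : ∀ a b u v U V → a * u + b * v + (a * U + b * V) ≡ a * (u + U) + b * (v + V)
  interchange = solve-∀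

length-filterᵇ : ∀ (p : A → Bool) xs → length (filterᵇ p xs) ≡ ∑[ x ∈ xs ] (if p x then 1 else 0)
length-filterᵇ p []       = refl
length-filterᵇ p (x ∷ xs) with p x
... | true  = cong suc (length-filterᵇ p xs)
... | false = length-filterᵇ p xs

δ : ℕ → ℕ → ℕ
δ k d = if d ≡ᵇ k then 1 else 0

δ-weight : ∀ (f : ℕ → ℕ) k d → f d * δ k d ≡ f k * δ k d
δ-weight f zero    zero    = refl
δ-weight f zero    (suc d) = trans (*-zeroʳ (f (suc d))) (sym (*-zeroʳ (f zero)))
δ-weight f (suc k) zero    = trans (*-zeroʳ (f zero)) (sym (*-zeroʳ (f (suc k))))
δ-weight f (suc k) (suc d) = δ-weight (f ∘ suc) k d

δ-pred : ∀ k d → d * δ k (pred d) ≡ suc k * δ (suc k) d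
δ-pred k zero    = sym (*-zeroʳ (suc k))
δ-pred k (suc d) = δ-weight suc k d

M-as-∑ : ∀ k m → M k m ≡ ∑[ σ ∈ S m ] δ k (desO σ)
M-as-∑ k m = length-filterᵇ (λ σ → desO σ ≡ᵇ k) (S m)

odd-double : ∀ n → odd (n * 2) ≡ false
odd-double n = cong (_≡ᵇ 1) (m*n%n≡0 n 2)

odd-suc-double : ∀ n → odd (suc (n * 2)) ≡ true
odd-suc-double n = cong (_≡ᵇ 1) ([m+kn]%n≡m%n 1 n 2)

length-insertions : ∀ x σ → All (λ τ → length τ ≡ suc (length σ)) (insertions x σ)
length-insertions x []       = refl ∷ []
length-insertions x (y ∷ ys) = refl ∷ map⁺ (All.map (cong suc) (length-insertions x ys))

All-insertions : ∀ {P : ℕ → Set} {x σ} → P x → All P σ → All (All P) (insertions x σ)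
All-insertions px []         = (px ∷ []) ∷ []
All-insertions px (py ∷ pys) = (px ∷ py ∷ pys) ∷ map⁺ (All.map (py ∷_) (All-insertions px pys))

S-length : ∀ m → All (λ σ → length σ ≡ m) (S m)
S-length zero    = refl ∷ []
S-length (suc m) = concat⁺ (map⁺ (All.map
  (λ {σ} len → All.map (λ len′ → trans len′ (cong suc len)) (length-insertions (suc m) σ))
  (S-length m)))

S-bounded : ∀ m → All (All (_< suc m)) (S m)
S-bounded zero    = [] ∷ []
S-bounded (suc m) = concat⁺ (map⁺ (All.map
  (λ σ≤m → All-insertions (n<1+n (suc m)) (All.map m<n⇒m<1+n σ≤m))
  (S-bounded m)))

<⇒<ᵇ≡true : ∀ {m n} → m < n → (m <ᵇ n) ≡ true
<⇒<ᵇ≡true m<n = Equivalence.to T-≡ (<⇒<ᵇ m<n)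

<⇒>ᵇ≡false : ∀ {m n} → m < n → (n <ᵇ m) ≡ false
<⇒>ᵇ≡false                 z<s       = refl
<⇒>ᵇ≡false {suc m} {suc n} (s<s m<n) = <⇒>ᵇ≡false m<n

desO-0∷ : ∀ σ → desO (0 ∷ σ) ≡ desO σ
desO-0∷ []      = refl
desO-0∷ (_ ∷ _) = refl

desO-∷-≤-length : ∀ p σ → desO (p ∷ σ) ≤ length σ
desO-∷-≤-length p []       = z≤n
desO-∷-≤-length p (y ∷ ys) with (y <ᵇ p) ∧ odd p
... | true  = s≤s (desO-∷-≤-length y ys)
... | false = m≤n⇒m≤1+n (desO-∷-≤-length y ys)

-- b is the odd-descent status of the pair (p, y) which the induction below
-- peels off the front of p ∷ y ∷ ys.
odd-insertion-step : ∀ b (g : ℕ → ℕ) {d ℓ} → d ≤ ℓ → let e = if b then 1 else 0 in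
  g (suc d) + (suc d * g (e + d) + (ℓ ∸ d) * g (e + suc d))
    ≡ suc (e + d) * g (e + d) + (suc ℓ ∸ (e + d)) * g (suc (e + d))
odd-insertion-step false g {d} {ℓ} d≤ℓ =
  trans (shift (g d) (g (suc d)) d (ℓ ∸ d))
        (cong (λ t → suc d * g d + t * g (suc d)) (sym (+-∸-assoc 1 d≤ℓ)))
  where
  shift : ∀ u v d t → v + (suc d * u + t * v) ≡ suc d * u + suc t * v
  shift = solve-∀
odd-insertion-step true  g {d} {ℓ} d≤ℓ =
  sym (+-assoc (g (suc d)) (suc d * g (suc d)) ((ℓ ∸ d) * g (suc (suc d))))

even-insertion-step : ∀ b (g : ℕ → ℕ) {d ℓ} → d ≤ ℓ → let e = if b then 1 else 0 in
  g d + ((suc ℓ ∸ d) * g (e + d) + d * g (e + pred d))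
    ≡ (suc (suc ℓ) ∸ (e + d)) * g (e + d) + (e + d) * g (pred (e + d))
even-insertion-step false g {d} {ℓ} d≤ℓ =
  trans (sym (+-assoc (g d) _ _))
        (cong (λ t → t * g d + d * g (pred d)) (sym (+-∸-assoc 1 (m≤n⇒m≤1+n d≤ℓ))))
even-insertion-step true  g {d} {ℓ} d≤ℓ =
  trans (cong (λ t → g d + ((suc ℓ ∸ d) * g (suc d) + t)) (suc-pred-weight d))
        (swap (g d) ((suc ℓ ∸ d) * g (suc d)) (d * g d))
  where
  suc-pred-weight : ∀ d → d * g (suc (pred d)) ≡ d * g d
  suc-pred-weight zero    = refl
  suc-pred-weight (suc _) = refl
  swap : ∀ u v w → u + (v + w) ≡ v + (u + w)
  swap = solve-∀

-- The list is preceded by an element p, so that the induction can carry the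
-- pair (p, y) along.
∑-insertions-odd-after : ∀ {x} → odd x ≡ true → ∀ {p} σ → All (_< x) (p ∷ σ) →
  (g : ℕ → ℕ) →
  ∑[ τ ∈ insertions x σ ] g (desO (p ∷ τ))
    ≡ suc (desO (p ∷ σ)) * g (desO (p ∷ σ)) + (length σ ∸ desO (p ∷ σ)) * g (suc (desO (p ∷ σ)))
∑-insertions-odd-after x-odd []       (p<x ∷ []) g rewrite <⇒>ᵇ≡false p<x = sym (+-identityʳ _)
∑-insertions-odd-after {x} x-odd {p} (y ∷ ys) (p<x ∷ y<x ∷ ys<x) g
  rewrite <⇒>ᵇ≡false p<x | <⇒<ᵇ≡true y<x | x-odd = begin
    g (suc d) + ∑[ τ ∈ map (y ∷_) (insertions x ys) ] g (desO (p ∷ τ))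
      ≡⟨ cong (g (suc d) +_) (∑-map (y ∷_) (insertions x ys) (λ τ → g (desO (p ∷ τ)))) ⟩
    g (suc d) + ∑[ τ ∈ insertions x ys ] g (e + desO (y ∷ τ))
      ≡⟨ cong (g (suc d) +_) (∑-insertions-odd-after x-odd ys (y<x ∷ ys<x) (λ j → g (e + j))) ⟩
    g (suc d) + (suc d * g (e + d) + (length ys ∸ d) * g (e + suc d))
      ≡⟨ odd-insertion-step ((y <ᵇ p) ∧ odd p) g (desO-∷-≤-length y ys) ⟩
    suc (e + d) * g (e + d) + (suc (length ys) ∸ (e + d)) * g (suc (e + d)) ∎
  where
  d = desO (y ∷ ys)
  e = if (y <ᵇ p) ∧ odd p then 1 else 0

∑-insertions-even-after : ∀ {x} → odd x ≡ false → ∀ {p} σ → All (_< x) (p ∷ σ) →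
  (g : ℕ → ℕ) →
  ∑[ τ ∈ insertions x σ ] g (desO (p ∷ τ))
    ≡ (suc (length σ) ∸ desO (p ∷ σ)) * g (desO (p ∷ σ)) + desO (p ∷ σ) * g (pred (desO (p ∷ σ)))
∑-insertions-even-after x-even []       (p<x ∷ []) g rewrite <⇒>ᵇ≡false p<x = sym (+-identityʳ _)
∑-insertions-even-after {x} x-even {p} (y ∷ ys) (p<x ∷ y<x ∷ ys<x) g
  rewrite <⇒>ᵇ≡false p<x | <⇒<ᵇ≡true y<x | x-even = begin
    g d + ∑[ τ ∈ map (y ∷_) (insertions x ys) ] g (desO (p ∷ τ))
      ≡⟨ cong (g d +_) (∑-map (y ∷_) (insertions x ys) (λ τ → g (desO (p ∷ τ)))) ⟩
    g d + ∑[ τ ∈ insertions x ys ] g (e + desO (y ∷ τ))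
      ≡⟨ cong (g d +_) (∑-insertions-even-after x-even ys (y<x ∷ ys<x) (λ j → g (e + j))) ⟩
    g d + ((suc (length ys) ∸ d) * g (e + d) + d * g (e + pred d))
      ≡⟨ even-insertion-step ((y <ᵇ p) ∧ odd p) g (desO-∷-≤-length y ys) ⟩
    (suc (suc (length ys)) ∸ (e + d)) * g (e + d) + (e + d) * g (pred (e + d)) ∎
  where
  d = desO (y ∷ ys)
  e = if (y <ᵇ p) ∧ odd p then 1 else 0

-- 0 serves as a sentinel: it never starts a descent, so desO (0 ∷ σ) = desO σ.
∑-insertions-odd : ∀ {m} → odd (suc m) ≡ true → ∀ {σ} → All (_< suc m) σ → (g : ℕ → ℕ) →
  ∑[ τ ∈ insertions (suc m) σ ] g (desO τ)
    ≡ suc (desO σ) * g (desO σ) + (length σ ∸ desO σ) * g (suc (desO σ))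
∑-insertions-odd m+1-odd {σ} σ≤m g rewrite sym (desO-0∷ σ) =
  trans (∑-cong (insertions _ σ) (λ τ → cong g (sym (desO-0∷ τ))))
        (∑-insertions-odd-after m+1-odd σ (z<s ∷ σ≤m) g)

∑-insertions-even : ∀ {m} → odd (suc m) ≡ false → ∀ {σ} → All (_< suc m) σ → (g : ℕ → ℕ) →
  ∑[ τ ∈ insertions (suc m) σ ] g (desO τ)
    ≡ (suc (length σ) ∸ desO σ) * g (desO σ) + desO σ * g (pred (desO σ))
∑-insertions-even m+1-even {σ} σ≤m g rewrite sym (desO-0∷ σ) =
  trans (∑-cong (insertions _ σ) (λ τ → cong g (sym (desO-0∷ τ))))
        (∑-insertions-even-after m+1-even σ (z<s ∷ σ≤m) g)

∑-S-suc : ∀ m (g : ℕ → ℕ) (F : ℕ → ℕ → ℕ) →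
  (∀ {σ} → All (_< suc m) σ → ∑[ τ ∈ insertions (suc m) σ ] g (desO τ) ≡ F (length σ) (desO σ)) →
  ∑[ τ ∈ S (suc m) ] g (desO τ) ≡ ∑[ σ ∈ S m ] F m (desO σ)
∑-S-suc m g F insert = trans (∑-concatMap (insertions (suc m)) (S m) (g ∘ desO))
  (∑-cong-All (All.zipWith (λ {σ} (len , σ≤m) → trans (insert σ≤m) (cong (λ ℓ → F ℓ (desO σ)) len))
                           (S-length m , S-bounded m)))

M-suc-even : ∀ {m} k → odd (suc m) ≡ false → M k (suc m) ≡ (suc m ∸ k) * M k m + suc k * M (suc k) m
M-suc-even {m} k m+1-even = begin
  M k (suc m)
    ≡⟨ M-as-∑ k (suc m) ⟩
  ∑[ τ ∈ S (suc m) ] δ k (desO τ)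
    ≡⟨ ∑-S-suc m (δ k) (λ ℓ d → (suc ℓ ∸ d) * δ k d + d * δ k (pred d))
               (λ σ≤m → ∑-insertions-even m+1-even σ≤m (δ k)) ⟩
  ∑[ σ ∈ S m ] ((suc m ∸ desO σ) * δ k (desO σ) + desO σ * δ k (pred (desO σ)))
    ≡⟨ ∑-cong (S m) (λ σ → cong₂ _+_ (δ-weight (suc m ∸_) k (desO σ)) (δ-pred k (desO σ))) ⟩
  ∑[ σ ∈ S m ] ((suc m ∸ k) * δ k (desO σ) + suc k * δ (suc k) (desO σ))
    ≡⟨ ∑-linear (suc m ∸ k) (suc k) (δ k ∘ desO) (δ (suc k) ∘ desO) (S m) ⟩
  (suc m ∸ k) * ∑[ σ ∈ S m ] δ k (desO σ) + suc k * ∑[ σ ∈ S m ] δ (suc k) (desO σ)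
    ≡⟨ sym (cong₂ (λ a b → (suc m ∸ k) * a + suc k * b) (M-as-∑ k m) (M-as-∑ (suc k) m)) ⟩
  (suc m ∸ k) * M k m + suc k * M (suc k) m ∎

M-suc-odd : ∀ {m} k → odd (suc m) ≡ true → M (suc k) (suc m) ≡ suc (suc k) * M (suc k) m + (m ∸ k) * M k m
M-suc-odd {m} k m+1-odd = begin
  M (suc k) (suc m)
    ≡⟨ M-as-∑ (suc k) (suc m) ⟩
  ∑[ τ ∈ S (suc m) ] δ (suc k) (desO τ)
    ≡⟨ ∑-S-suc m (δ (suc k)) (λ ℓ d → suc d * δ (suc k) d + (ℓ ∸ d) * δ (suc k) (suc d))
               (λ σ≤m → ∑-insertions-odd m+1-odd σ≤m (δ (suc k))) ⟩
  ∑[ σ ∈ S m ] (suc (desO σ) * δ (suc k) (desO σ) + (m ∸ desO σ) * δ k (desO σ))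
    ≡⟨ ∑-cong (S m) (λ σ → cong₂ _+_ (δ-weight suc (suc k) (desO σ)) (δ-weight (m ∸_) k (desO σ))) ⟩
  ∑[ σ ∈ S m ] (suc (suc k) * δ (suc k) (desO σ) + (m ∸ k) * δ k (desO σ))
    ≡⟨ ∑-linear (suc (suc k)) (m ∸ k) (δ (suc k) ∘ desO) (δ k ∘ desO) (S m) ⟩
  suc (suc k) * ∑[ σ ∈ S m ] δ (suc k) (desO σ) + (m ∸ k) * ∑[ σ ∈ S m ] δ k (desO σ)
    ≡⟨ sym (cong₂ (λ a b → suc (suc k) * a + (m ∸ k) * b) (M-as-∑ (suc k) m) (M-as-∑ k m)) ⟩
  suc (suc k) * M (suc k) m + (m ∸ k) * M k m ∎

M-zero-suc-odd : ∀ {m} → odd (suc m) ≡ true → M 0 (suc m) ≡ M 0 m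
M-zero-suc-odd {m} m+1-odd = begin
  M 0 (suc m)
    ≡⟨ M-as-∑ 0 (suc m) ⟩
  ∑[ τ ∈ S (suc m) ] δ 0 (desO τ)
    ≡⟨ ∑-S-suc m (δ 0) (λ ℓ d → suc d * δ 0 d + (ℓ ∸ d) * δ 0 (suc d))
               (λ σ≤m → ∑-insertions-odd m+1-odd σ≤m (δ 0)) ⟩
  ∑[ σ ∈ S m ] (suc (desO σ) * δ 0 (desO σ) + (m ∸ desO σ) * 0)
    ≡⟨ ∑-cong (S m) (λ σ → trans (cong₂ _+_ (trans (δ-weight suc 0 (desO σ)) (*-identityˡ _))
                                            (*-zeroʳ (m ∸ desO σ)))
                                 (+-identityʳ _)) ⟩
  ∑[ σ ∈ S m ] δ 0 (desO σ)
    ≡⟨ sym (M-as-∑ 0 m) ⟩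
  M 0 m ∎

absorption : ∀ n k → suc k * (suc n C suc k) ≡ suc n * (n C k)
absorption zero    zero    = refl
absorption zero    (suc k) =
  trans (cong (suc (suc k) *_) (k>n⇒nCk≡0 {1} {suc (suc k)} (s<s z<s))) (*-zeroʳ (suc (suc k)))
absorption (suc n) zero    = trans (*-identityˡ _) (trans (nC1≡n (suc (suc n))) (sym (*-identityʳ _)))
absorption (suc n) (suc k) = begin
  suc (suc k) * (suc (suc n) C suc (suc k))
    ≡⟨ cong (suc (suc k) *_) (sym (nCk+nC[k+1]≡[n+1]C[k+1] (suc n) (suc k))) ⟩
  suc (suc k) * (suc n C suc k + suc n C suc (suc k))
    ≡⟨ trans (*-distribˡ-+ (suc (suc k)) (suc n C suc k) _) (+-assoc (suc n C suc k) _ _) ⟩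
  suc n C suc k + (suc k * (suc n C suc k) + suc (suc k) * (suc n C suc (suc k)))
    ≡⟨ cong (suc n C suc k +_) (cong₂ _+_ (absorption n k) (absorption n (suc k))) ⟩
  suc n C suc k + (suc n * (n C k) + suc n * (n C suc k))
    ≡⟨ cong (suc n C suc k +_) (sym (*-distribˡ-+ (suc n) (n C k) _)) ⟩
  suc n C suc k + suc n * (n C k + n C suc k)
    ≡⟨ cong (λ t → suc n C suc k + suc n * t) (nCk+nC[k+1]≡[n+1]C[k+1] n k) ⟩
  suc (suc n) * (suc n C suc k) ∎

absorption-∸ : ∀ n k → (n ∸ k) * (n C k) ≡ suc k * (n C suc k)
absorption-∸ n k with k ≤? n
... | yes k≤n = +-cancelˡ-≡ (suc k * (n C k)) _ _ (begin
  suc k * (n C k) + (n ∸ k) * (n C k)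
    ≡⟨ sym (*-distribʳ-+ (n C k) (suc k) (n ∸ k)) ⟩
  suc (k + (n ∸ k)) * (n C k)
    ≡⟨ cong (λ t → suc t * (n C k)) (m+[n∸m]≡n k≤n) ⟩
  suc n * (n C k)
    ≡⟨ sym (absorption n k) ⟩
  suc k * (suc n C suc k)
    ≡⟨ cong (suc k *_) (sym (nCk+nC[k+1]≡[n+1]C[k+1] n k)) ⟩
  suc k * (n C k + n C suc k)
    ≡⟨ *-distribˡ-+ (suc k) (n C k) (n C suc k) ⟩
  suc k * (n C k) + suc k * (n C suc k) ∎)
... | no k≰n  = begin
  (n ∸ k) * (n C k)      ≡⟨ cong ((n ∸ k) *_) (k>n⇒nCk≡0 (≰⇒> k≰n)) ⟩
  (n ∸ k) * 0            ≡⟨ *-zeroʳ (n ∸ k) ⟩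
  0                      ≡⟨ sym (*-zeroʳ (suc k)) ⟩
  suc k * 0              ≡⟨ cong (suc k *_) (sym (k>n⇒nCk≡0 (m<n⇒m<1+n (≰⇒> k≰n)))) ⟩
  suc k * (n C suc k)    ∎

absorption-∸-suc : ∀ n k → (suc n ∸ k) * (suc n C k) ≡ suc n * (n C k)
absorption-∸-suc n k = trans (absorption-∸ (suc n) k) (absorption n k)

-- Splitting m + n ∸ k as m + (n ∸ k) is only valid for k ≤ n; otherwise n C k vanishes.
split-∸-coefficient : ∀ m n k {t} → m + n ≡ t → (t ∸ k) * (n C k) ≡ m * (n C k) + (n ∸ k) * (n C k)
split-∸-coefficient m n k refl with k ≤? n
... | yes k≤n = trans (cong (_* (n C k)) (+-∸-assoc m k≤n)) (*-distribʳ-+ (n C k) m (n ∸ k))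
... | no k≰n rewrite k>n⇒nCk≡0 (≰⇒> k≰n) | *-zeroʳ (m + n ∸ k) | *-zeroʳ m | *-zeroʳ (n ∸ k) = refl

coefficient-even : ∀ n k → (suc n * 2 ∸ k) * (suc n C k) ≡ suc n * (suc n C k + n C k)
coefficient-even n k = begin
  (suc n * 2 ∸ k) * (suc n C k)
    ≡⟨ split-∸-coefficient (suc n) (suc n) k (twice n) ⟩
  suc n * (suc n C k) + (suc n ∸ k) * (suc n C k)
    ≡⟨ cong (suc n * (suc n C k) +_) (absorption-∸-suc n k) ⟩
  suc n * (suc n C k) + suc n * (n C k)
    ≡⟨ sym (*-distribˡ-+ (suc n) (suc n C k) (n C k)) ⟩
  suc n * (suc n C k + n C k) ∎
  where
  twice : ∀ n → suc n + suc n ≡ suc n * 2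
  twice = solve-∀

coefficient-odd : ∀ n k → (suc n * 2 ∸ k) * (n C k) ≡ suc (suc n) * (n C k) + suc k * (n C suc k)
coefficient-odd n k =
  trans (split-∸-coefficient (suc (suc n)) n k (twice n)) (cong (suc (suc n) * (n C k) +_) (absorption-∸ n k))
  where
  twice : ∀ n → suc (suc n) + n ≡ suc n * 2
  twice = solve-∀

-- oddClosedForm n k and evenClosedForm n k are the values claimed for M_{k,2n+1}
-- and M_{k,2n+2}.
oddBinomials : ℕ → ℕ → ℕ
oddBinomials n k = (n C k) * (suc n C k)

evenBinomials : ℕ → ℕ → ℕ
evenBinomials n k = (n C k) * (suc (suc n) C suc k)

oddClosedForm : ℕ → ℕ → ℕ
oddClosedForm n k = oddBinomials n k * (n ! * suc n !)

evenClosedForm : ℕ → ℕ → ℕ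
evenClosedForm n k = evenBinomials n k * (suc n ! * suc n !)

binomial-identity-even : ∀ n k →
  (suc n * 2 ∸ k) * oddBinomials n k + suc k * oddBinomials n (suc k) ≡ suc n * evenBinomials n k
binomial-identity-even n k =
  identity {suc n * 2 ∸ k} {n C k} {suc n C k} {n C suc k} {suc n C suc k} {suc (suc n) C suc k}
    (coefficient-even n k) (absorption n k) (nCk+nC[k+1]≡[n+1]C[k+1] n k) (nCk+nC[k+1]≡[n+1]C[k+1] (suc n) k)
  where
  identity : ∀ {x a b c d e} → x * b ≡ suc n * (b + a) → suc k * d ≡ suc n * a →
             a + c ≡ d → b + d ≡ e → x * (a * b) + suc k * (c * d) ≡ suc n * (a * e)
  identity {x} {a} {b} {c} {d} {e} xb sd a+c b+d = begin
    x * (a * b) + suc k * (c * d)          ≡⟨ regroup x (suc k) a b c d ⟩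
    (x * b) * a + (suc k * d) * c          ≡⟨ cong₂ (λ u v → u * a + v * c) xb sd ⟩
    suc n * (b + a) * a + suc n * a * c    ≡⟨ collect (suc n) a b c ⟩
    suc n * (a * (b + (a + c)))            ≡⟨ cong (λ u → suc n * (a * (b + u))) a+c ⟩
    suc n * (a * (b + d))                  ≡⟨ cong (λ u → suc n * (a * u)) b+d ⟩
    suc n * (a * e)                        ∎
    where
    regroup : ∀ x y a b c d → x * (a * b) + y * (c * d) ≡ (x * b) * a + (y * d) * c
    regroup = solve-∀
    collect : ∀ s a b c → s * (b + a) * a + s * a * c ≡ s * (a * (b + (a + c)))
    collect = solve-∀

binomial-identity-odd : ∀ n k →
  suc (suc k) * evenBinomials n (suc k) + (suc n * 2 ∸ k) * evenBinomials n k
    ≡ suc (suc n) * oddBinomials (suc n) (suc k)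
binomial-identity-odd n k =
  identity {suc n * 2 ∸ k} {n C k} {suc n C k} {n C suc k} {suc n C suc k}
           {suc (suc n) C suc k} {suc (suc n) C suc (suc k)}
    (absorption (suc n) (suc k)) (coefficient-odd n k) (absorption (suc n) k)
    (nCk+nC[k+1]≡[n+1]C[k+1] (suc n) k) (nCk+nC[k+1]≡[n+1]C[k+1] n k)
  where
  s = suc (suc n)
  identity : ∀ {x a b c d e f} → suc (suc k) * f ≡ s * d → x * a ≡ s * a + suc k * c →
             suc k * e ≡ s * b → b + d ≡ e → a + c ≡ d → suc (suc k) * (c * f) + x * (a * e) ≡ s * (d * e)
  identity {x} {a} {b} {c} {d} {e} {f} sf xa se b+d a+c = begin
    suc (suc k) * (c * f) + x * (a * e)      ≡⟨ regroup (suc (suc k)) x a c e f ⟩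
    c * (suc (suc k) * f) + (x * a) * e      ≡⟨ cong₂ (λ u v → c * u + v * e) sf xa ⟩
    c * (s * d) + (s * a + suc k * c) * e    ≡⟨ expand s (suc k) a c d e ⟩
    s * (c * d + a * e) + c * (suc k * e)    ≡⟨ cong (λ u → s * (c * d + a * e) + c * u) se ⟩
    s * (c * d + a * e) + c * (s * b)        ≡⟨ collect s a b c d e ⟩
    s * (a * e + c * (b + d))                ≡⟨ cong (λ u → s * (a * e + c * u)) b+d ⟩
    s * (a * e + c * e)                      ≡⟨ cong (s *_) (sym (*-distribʳ-+ e a c)) ⟩
    s * ((a + c) * e)                        ≡⟨ cong (λ u → s * (u * e)) a+c ⟩
    s * (d * e)                              ∎
    where
    regroup : ∀ y x a c e f → y * (c * f) + x * (a * e) ≡ c * (y * f) + (x * a) * e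
    regroup = solve-∀
    expand : ∀ s t a c d e → c * (s * d) + (s * a + t * c) * e ≡ s * (c * d + a * e) + c * (t * e)
    expand = solve-∀
    collect : ∀ s a b c d e → s * (c * d + a * e) + c * (s * b) ≡ s * (a * e + c * (b + d))
    collect = solve-∀

factorʳ : ∀ x a y b p → x * (a * p) + y * (b * p) ≡ (x * a + y * b) * p
factorʳ = solve-∀

evenClosedForm-step : ∀ n k →
  (suc n * 2 ∸ k) * oddClosedForm n k + suc k * oddClosedForm n (suc k) ≡ evenClosedForm n k
evenClosedForm-step n k = begin
  (suc n * 2 ∸ k) * oddClosedForm n k + suc k * oddClosedForm n (suc k)
    ≡⟨ factorʳ (suc n * 2 ∸ k) (oddBinomials n k) (suc k) (oddBinomials n (suc k)) (n ! * suc n !) ⟩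
  ((suc n * 2 ∸ k) * oddBinomials n k + suc k * oddBinomials n (suc k)) * (n ! * suc n !)
    ≡⟨ cong (_* (n ! * suc n !)) (binomial-identity-even n k) ⟩
  suc n * evenBinomials n k * (n ! * suc n !)
    ≡⟨ regroup (suc n) (evenBinomials n k) (n !) (suc n !) ⟩
  evenClosedForm n k ∎
  where
  regroup : ∀ s e f g → s * e * (f * g) ≡ e * (s * f * g)
  regroup = solve-∀

oddClosedForm-step : ∀ n k →
  suc (suc k) * evenClosedForm n (suc k) + (suc n * 2 ∸ k) * evenClosedForm n k ≡ oddClosedForm (suc n) (suc k)
oddClosedForm-step n k = begin
  suc (suc k) * evenClosedForm n (suc k) + (suc n * 2 ∸ k) * evenClosedForm n k
    ≡⟨ factorʳ (suc (suc k)) (evenBinomials n (suc k)) (suc n * 2 ∸ k) (evenBinomials n k)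
               (suc n ! * suc n !) ⟩
  (suc (suc k) * evenBinomials n (suc k) + (suc n * 2 ∸ k) * evenBinomials n k) * (suc n ! * suc n !)
    ≡⟨ cong (_* (suc n ! * suc n !)) (binomial-identity-odd n k) ⟩
  suc (suc n) * oddBinomials (suc n) (suc k) * (suc n ! * suc n !)
    ≡⟨ regroup (suc (suc n)) (oddBinomials (suc n) (suc k)) (suc n !) ⟩
  oddClosedForm (suc n) (suc k) ∎
  where
  regroup : ∀ s e f → s * e * (f * f) ≡ e * (f * (s * f))
  regroup = solve-∀

oddClosedForm-zero : ∀ n → evenClosedForm n 0 ≡ oddClosedForm (suc n) 0
oddClosedForm-zero n =
  trans (cong (λ c → (1 * c) * (suc n ! * suc n !)) (nC1≡n (suc (suc n)))) (regroup (suc (suc n)) (suc n !))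
  where
  regroup : ∀ s f → 1 * s * (f * f) ≡ 1 * 1 * (f * (s * f))
  regroup = solve-∀

-- Indices are written with n * 2 so that suc n * 2 reduces to suc (suc (n * 2))
-- and the recurrences apply without rewriting.
M[1+n*2]≡oddClosedForm : ∀ n k → M k (suc (n * 2)) ≡ oddClosedForm n k
M[[1+n]*2]≡evenClosedForm : ∀ n k → M k (suc n * 2) ≡ evenClosedForm n k

M[1+n*2]≡oddClosedForm zero    zero    = refl
M[1+n*2]≡oddClosedForm zero    (suc k) = refl
M[1+n*2]≡oddClosedForm (suc n) zero    = begin
  M 0 (suc (suc n * 2))  ≡⟨ M-zero-suc-odd {suc n * 2} (odd-suc-double (suc n)) ⟩
  M 0 (suc n * 2)        ≡⟨ M[[1+n]*2]≡evenClosedForm n 0 ⟩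
  evenClosedForm n 0     ≡⟨ oddClosedForm-zero n ⟩
  oddClosedForm (suc n) 0 ∎
M[1+n*2]≡oddClosedForm (suc n) (suc k) = begin
  M (suc k) (suc (suc n * 2))
    ≡⟨ M-suc-odd {suc n * 2} k (odd-suc-double (suc n)) ⟩
  suc (suc k) * M (suc k) (suc n * 2) + (suc n * 2 ∸ k) * M k (suc n * 2)
    ≡⟨ cong₂ (λ a b → suc (suc k) * a + (suc n * 2 ∸ k) * b)
             (M[[1+n]*2]≡evenClosedForm n (suc k)) (M[[1+n]*2]≡evenClosedForm n k) ⟩
  suc (suc k) * evenClosedForm n (suc k) + (suc n * 2 ∸ k) * evenClosedForm n k
    ≡⟨ oddClosedForm-step n k ⟩
  oddClosedForm (suc n) (suc k) ∎

M[[1+n]*2]≡evenClosedForm n k = begin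
  M k (suc n * 2)
    ≡⟨ M-suc-even {suc (n * 2)} k (odd-double (suc n)) ⟩
  (suc n * 2 ∸ k) * M k (suc (n * 2)) + suc k * M (suc k) (suc (n * 2))
    ≡⟨ cong₂ (λ a b → (suc n * 2 ∸ k) * a + suc k * b)
             (M[1+n*2]≡oddClosedForm n k) (M[1+n*2]≡oddClosedForm n (suc k)) ⟩
  (suc n * 2 ∸ k) * oddClosedForm n k + suc k * oddClosedForm n (suc k)
    ≡⟨ evenClosedForm-step n k ⟩
  evenClosedForm n k ∎

M[2*n+1]≡oddClosedForm : ∀ n k → M k (2 * n + 1) ≡ oddClosedForm n k
M[2*n+1]≡oddClosedForm n k = trans (cong (M k) (index n)) (M[1+n*2]≡oddClosedForm n k)
  where
  index : ∀ n → 2 * n + 1 ≡ suc (n * 2)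
  index = solve-∀

M[2*[1+n]]≡evenClosedForm : ∀ n k → M k (2 * suc n) ≡ evenClosedForm n k
M[2*[1+n]]≡evenClosedForm n k = trans (cong (M k) (*-comm 2 (suc n))) (M[[1+n]*2]≡evenClosedForm n k)

M-odd-formula : ∀ n k → M k (2 * n + 1) ≡ (n C k) * ((n + 1) C k) * (n !) * ((n + 1) !)
M-odd-formula n k rewrite +-comm n 1 =
  trans (M[2*n+1]≡oddClosedForm n k) (sym (*-assoc (oddBinomials n k) (n !) (suc n !)))

M-odd-formula-scaled : ∀ n k → k ≤ n →
  (n ∸ k + 1) * M k (2 * n + 1) ≡ (n C k) * (n C k) * (((n + 1) !) * ((n + 1) !))
M-odd-formula-scaled n k k≤n rewrite +-comm n 1 = begin
  (n ∸ k + 1) * M k (2 * n + 1)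
    ≡⟨ cong₂ _*_ (trans (+-comm (n ∸ k) 1) (sym (+-∸-assoc 1 k≤n))) (M[2*n+1]≡oddClosedForm n k) ⟩
  (suc n ∸ k) * oddClosedForm n k
    ≡⟨ regroup (suc n ∸ k) (n C k) (suc n C k) (n !) (suc n !) ⟩
  (n C k) * ((suc n ∸ k) * (suc n C k)) * (n ! * suc n !)
    ≡⟨ cong (λ t → (n C k) * t * (n ! * suc n !)) (absorption-∸-suc n k) ⟩
  (n C k) * (suc n * (n C k)) * (n ! * suc n !)
    ≡⟨ regroup′ (suc n) (n C k) (n !) (suc n !) ⟩
  (n C k) * (n C k) * (suc n ! * suc n !) ∎
  where
  regroup : ∀ x a b f g → x * ((a * b) * (f * g)) ≡ a * (x * b) * (f * g)
  regroup = solve-∀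
  regroup′ : ∀ s a f g → a * (s * a) * (f * g) ≡ a * a * (s * f * g)
  regroup′ = solve-∀

M-even-formula : ∀ n k → M k (2 * suc n) ≡ (n C k) * ((suc n + 1) C (k + 1)) * ((suc n !) * (suc n !))
M-even-formula n k rewrite +-comm n 1 | +-comm k 1 = M[2*[1+n]]≡evenClosedForm n k

M-even-formula-scaled : ∀ n k →
  suc k * M k (2 * suc n) ≡ (suc n + 1) * ((n C k) * (suc n C k) * ((suc n !) * (suc n !)))
M-even-formula-scaled n k rewrite +-comm n 1 = begin
  suc k * M k (2 * suc n)
    ≡⟨ cong (suc k *_) (M[2*[1+n]]≡evenClosedForm n k) ⟩
  suc k * evenClosedForm n k
    ≡⟨ regroup (suc k) (n C k) (suc (suc n) C suc k) (suc n ! * suc n !) ⟩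
  (n C k) * (suc k * (suc (suc n) C suc k)) * (suc n ! * suc n !)
    ≡⟨ cong (λ t → (n C k) * t * (suc n ! * suc n !)) (absorption (suc n) k) ⟩
  (n C k) * (suc (suc n) * (suc n C k)) * (suc n ! * suc n !)
    ≡⟨ regroup′ (suc (suc n)) (n C k) (suc n C k) (suc n ! * suc n !) ⟩
  suc (suc n) * ((n C k) * (suc n C k) * (suc n ! * suc n !)) ∎
  where
  regroup : ∀ x a b q → x * ((a * b) * q) ≡ a * (x * b) * q
  regroup = solve-∀
  regroup′ : ∀ s a b q → a * (s * b) * q ≡ s * (a * b * q)
  regroup′ = solve-∀

theorem6p1 : (n k : ℕ) → 1 ≤ n → k ≤ n →
    ((suc k * M k (2 * n) ≡ (n + 1) * (((n ∸ 1) C k) * (n C k) * ((n !) * (n !))))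
      × (M k (2 * n) ≡ ((n ∸ 1) C k) * ((n + 1) C (k + 1)) * ((n !) * (n !))))
    × (((n ∸ k + 1) * M k (2 * n + 1) ≡ (n C k) * (n C k) * (((n + 1) !) * ((n + 1) !)))
      × (M k (2 * n + 1) ≡ (n C k) * ((n + 1) C k) * (n !) * ((n + 1) !)))
theorem6p1 (suc n) k _ k≤n =
  (M-even-formula-scaled n k , M-even-formula n k) , (M-odd-formula-scaled (suc n) k k≤n , M-odd-formula (suc n) k)
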